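{- Let $(A,\rightarrow,\rightsquigarrow,1)$ be a pseudo-BE algebra and $\varphi:A\to\mathbb{R}$ a map with $\varphi(1)=0$. Then $\varphi$ is a pseudo-valuation on $A$ if and only if for all $x,y,z\in A$: $(pv_4)$ $\varphi(x\rightarrow z)\le\varphi(x\rightarrow(y\rightsquigarrow z))+\varphi(y)$ and $(pv_5)$ $\varphi(x\rightsquigarrow z)\le\varphi(x\rightsquigarrow(y\rightarrow z))+\varphi(y)$.
   Context: A pseudo-BE algebra is an algebra $(A,\rightarrow,\rightsquigarrow,1)$ of type $(2,2,0)$ such that for all $x,y,z\in A$: $x\rightarrow x=x\rightsquigarrow x=1$; $x\rightarrow 1=x\rightsquigarrow 1=1$; $1\rightarrow x=1\rightsquigarrow x=x$; $x\rightarrow(y\rightsquigarrow z)=y\rightsquigarrow(x\rightarrow z)$; $x\rightarrow y=1$ iff $x\rightsquigarrow y=1$. A pseudo-valuation on $A$ is a map $\varphi:A\to\mathbb{R}$ with $\varphi(1)=0$ and $\varphi(y)-\varphi(x)\le\min\{\varphi(x\rightarrow y),\varphi(x\rightsquigarrow y)\}$ for all $x,y\in A$. -}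

module Defs where

open import Level using (Level; suc; _⊔_)
open import Data.Product using (_×_)
open import Data.Sum using (_⊎_)
open import Relation.Binary.PropositionalEquality using (_≡_)

record PseudoBE (a : Level) : Set (suc a) where
  infixr 5 _⇒_ _⇝_
  field
    Carrier : Set a
    _⇒_     : Carrier → Carrier → Carrier
    _⇝_     : Carrier → Carrier → Carrier
    𝟏       : Carrier
    refl⇒   : ∀ x → x ⇒ x ≡ 𝟏
    refl⇝   : ∀ x → x ⇝ x ≡ 𝟏
    top⇒    : ∀ x → x ⇒ 𝟏 ≡ 𝟏
    top⇝    : ∀ x → x ⇝ 𝟏 ≡ 𝟏
    unit⇒   : ∀ x → 𝟏 ⇒ x ≡ x
    unit⇝   : ∀ x → 𝟏 ⇝ x ≡ x
    exch    : ∀ x y z → x ⇒ (y ⇝ z) ≡ y ⇝ (x ⇒ z)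
    ⇒1→⇝1   : ∀ x y → x ⇒ y ≡ 𝟏 → x ⇝ y ≡ 𝟏
    ⇝1→⇒1   : ∀ x y → x ⇝ y ≡ 𝟏 → x ⇒ y ≡ 𝟏

-- Stand-in for the codomain ℝ (agda-stdlib has no reals): an arbitrary
-- totally ordered abelian group with a binary minimum.  ℝ is an instance.
record TotallyOrderedAbelianGroup (r : Level) : Set (suc r) where
  infixl 6 _+_ _-_
  infix 4 _≤_
  infixl 7 _⊓_
  field
    R        : Set r
    _+_      : R → R → R
    0#       : R
    -_       : R → R
    _≤_      : R → R → Set r
    +-assoc  : ∀ x y z → (x + y) + z ≡ x + (y + z)
    +-comm   : ∀ x y → x + y ≡ y + x
    +-idʳ    : ∀ x → x + 0# ≡ x
    +-invʳ   : ∀ x → x + (- x) ≡ 0#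
    ≤-refl   : ∀ x → x ≤ x
    ≤-trans  : ∀ {x y z} → x ≤ y → y ≤ z → x ≤ z
    ≤-antisym : ∀ {x y} → x ≤ y → y ≤ x → x ≡ y
    ≤-total  : ∀ x y → (x ≤ y) ⊎ (y ≤ x)
    +-monoˡ-≤ : ∀ {x y} z → x ≤ y → x + z ≤ y + z
    _⊓_      : R → R → R
    ⊓-minl   : ∀ x y → (x ≤ y) → x ⊓ y ≡ x
    ⊓-minr   : ∀ x y → (y ≤ x) → x ⊓ y ≡ y
  _-_ : R → R → R
  x - y = x + (- y)

module _ {a r : Level} (A : PseudoBE a) (G : TotallyOrderedAbelianGroup r) where
  open PseudoBE A
  open TotallyOrderedAbelianGroup G

  IsPseudoValuation : (Carrier → R) → Set (a ⊔ r)
  IsPseudoValuation φ =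
    (φ 𝟏 ≡ 0#) ×
    (∀ x y → φ y - φ x ≤ φ (x ⇒ y) ⊓ φ (x ⇝ y))

  PV4 : (Carrier → R) → Set (a ⊔ r)
  PV4 φ = ∀ x y z → φ (x ⇒ z) ≤ φ (x ⇒ (y ⇝ z)) + φ y

  PV5 : (Carrier → R) → Set (a ⊔ r)
  PV5 φ = ∀ x y z → φ (x ⇝ z) ≤ φ (x ⇝ (y ⇒ z)) + φ y

module Submission where

-- Subtracting φ(x) and bounding by a minimum are both
-- reversible, so the pseudo-valuation inequality
--   φ(y) - φ(x) ≤ min{φ(x → y), φ(x ⇝ y)}
-- splits into the two "triangle inequalities"
--   (⇒-bound)  φ(y) ≤ φ(x → y) + φ(x)     (⇝-bound)  φ(y) ≤ φ(x ⇝ y) + φ(x).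
-- Each of these is in turn equivalent to one of (pv4), (pv5): the
-- exchange axiom x → (y ⇝ z) = y ⇝ (x → z) turns the ⇝-bound at the pair
-- (y, x → z) into (pv4), and conversely (pv4) at x = 1 is the ⇝-bound
-- because 1 → u = u; symmetrically the ⇒-bound corresponds to (pv5).

open import Defs
open import Level using (Level; _⊔_)
open import Data.Product using (_×_; _,_; proj₁; proj₂; swap)
open import Data.Product.Function.NonDependent.Propositional using (_×-⇔_)
open import Data.Sum using (inj₁; inj₂)
open import Function.Bundles using (_⇔_; mk⇔; module Equivalence)
open import Function.Properties.Equivalence using () renaming (trans to ⇔-trans)
open import Relation.Binary.PropositionalEquality
  using (_≡_; sym; trans; cong; subst; subst₂)

open Equivalence using (to; from)

module OrderedGroupFacts {r : Level} (G : TotallyOrderedAbelianGroup r) where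
  open TotallyOrderedAbelianGroup G

  ⊓-lowerˡ : ∀ a b → a ⊓ b ≤ a
  ⊓-lowerˡ a b with ≤-total a b
  ... | inj₁ a≤b = subst (_≤ a) (sym (⊓-minl a b a≤b)) (≤-refl a)
  ... | inj₂ b≤a = subst (_≤ a) (sym (⊓-minr a b b≤a)) b≤a

  ⊓-lowerʳ : ∀ a b → a ⊓ b ≤ b
  ⊓-lowerʳ a b with ≤-total a b
  ... | inj₁ a≤b = subst (_≤ b) (sym (⊓-minl a b a≤b)) a≤b
  ... | inj₂ b≤a = subst (_≤ b) (sym (⊓-minr a b b≤a)) (≤-refl b)

  ⊓-greatest : ∀ {c} a b → c ≤ a → c ≤ b → c ≤ a ⊓ b
  ⊓-greatest {c} a b c≤a c≤b with ≤-total a b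
  ... | inj₁ a≤b = subst (c ≤_) (sym (⊓-minl a b a≤b)) c≤a
  ... | inj₂ b≤a = subst (c ≤_) (sym (⊓-minr a b b≤a)) c≤b

  ≤⊓⇔ : ∀ c a b → (c ≤ a ⊓ b) ⇔ ((c ≤ a) × (c ≤ b))
  ≤⊓⇔ c a b = mk⇔
    (λ c≤a⊓b → ≤-trans c≤a⊓b (⊓-lowerˡ a b) , ≤-trans c≤a⊓b (⊓-lowerʳ a b))
    (λ { (c≤a , c≤b) → ⊓-greatest a b c≤a c≤b })

  sub-add-cancel : ∀ a c → (a - c) + c ≡ a
  sub-add-cancel a c =
    trans (+-assoc a (- c) c)
      (trans (cong (a +_) (trans (+-comm (- c) c) (+-invʳ c))) (+-idʳ a))

  add-sub-cancel : ∀ b c → (b + c) - c ≡ b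
  add-sub-cancel b c =
    trans (+-assoc b c (- c)) (trans (cong (b +_) (+-invʳ c)) (+-idʳ b))

  -≤⇔≤+ : ∀ a b c → (a - c ≤ b) ⇔ (a ≤ b + c)
  -≤⇔≤+ a b c = mk⇔
    (λ a-c≤b → subst (_≤ b + c) (sub-add-cancel a c) (+-monoˡ-≤ c a-c≤b))
    (λ a≤b+c → subst (a - c ≤_) (add-sub-cancel b c) (+-monoˡ-≤ (- c) a≤b+c))

module Valuation {a r : Level} (A : PseudoBE a) (G : TotallyOrderedAbelianGroup r)
                 (φ : PseudoBE.Carrier A → TotallyOrderedAbelianGroup.R G) where
  open PseudoBE A
  open TotallyOrderedAbelianGroup G
  open OrderedGroupFacts G

  ⇒-Bound : Set (a ⊔ r)
  ⇒-Bound = ∀ x y → φ y ≤ φ (x ⇒ y) + φ x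

  ⇝-Bound : Set (a ⊔ r)
  ⇝-Bound = ∀ x y → φ y ≤ φ (x ⇝ y) + φ x

  ineq⇔bounds-at : ∀ x y →
    (φ y - φ x ≤ φ (x ⇒ y) ⊓ φ (x ⇝ y))
      ⇔ ((φ y ≤ φ (x ⇒ y) + φ x) × (φ y ≤ φ (x ⇝ y) + φ x))
  ineq⇔bounds-at x y =
    ⇔-trans (≤⊓⇔ (φ y - φ x) (φ (x ⇒ y)) (φ (x ⇝ y)))
            (-≤⇔≤+ _ _ (φ x) ×-⇔ -≤⇔≤+ _ _ (φ x))

  valuation-ineq⇔bounds :
    (∀ x y → φ y - φ x ≤ φ (x ⇒ y) ⊓ φ (x ⇝ y)) ⇔ (⇒-Bound × ⇝-Bound)
  valuation-ineq⇔bounds = mk⇔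
    (λ ineq → (λ x y → proj₁ (to (ineq⇔bounds-at x y) (ineq x y)))
            , (λ x y → proj₂ (to (ineq⇔bounds-at x y) (ineq x y))))
    (λ { (b⇒ , b⇝) x y → from (ineq⇔bounds-at x y) (b⇒ x y , b⇝ x y) })

  -- (pv4) is the ⇝-bound at (y, x → z), rewritten by exchange;
  -- conversely the ⇝-bound is (pv4) at x = 1.
  ⇝-Bound⇔PV4 : ⇝-Bound ⇔ PV4 A G φ
  ⇝-Bound⇔PV4 = mk⇔
    (λ b x y z → subst (λ t → φ (x ⇒ z) ≤ φ t + φ y) (sym (exch x y z))
                   (b y (x ⇒ z)))
    (λ pv4 x y → subst₂ (λ s t → φ s ≤ φ t + φ x) (unit⇒ y) (unit⇒ (x ⇝ y))
                   (pv4 𝟏 x y))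

  -- Symmetrically, (pv5) is the ⇒-bound at (y, x ⇝ z), and the ⇒-bound
  -- is (pv5) at x = 1.
  ⇒-Bound⇔PV5 : ⇒-Bound ⇔ PV5 A G φ
  ⇒-Bound⇔PV5 = mk⇔
    (λ b x y z → subst (λ t → φ (x ⇝ z) ≤ φ t + φ y) (exch y x z)
                   (b y (x ⇝ z)))
    (λ pv5 x y → subst₂ (λ s t → φ s ≤ φ t + φ x) (unit⇝ y) (unit⇝ (x ⇒ y))
                   (pv5 𝟏 x y))

theorem6p3 : {a r : Level} (A : PseudoBE a) (G : TotallyOrderedAbelianGroup r)
    (φ : PseudoBE.Carrier A → TotallyOrderedAbelianGroup.R G) →
    φ (PseudoBE.𝟏 A) ≡ TotallyOrderedAbelianGroup.0# G →
    IsPseudoValuation A G φ ⇔ (PV4 A G φ × PV5 A G φ)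
theorem6p3 A G φ φ𝟏≡0 = mk⇔
  (λ { (_ , ineq) → swap (to bounds⇔pv (to valuation-ineq⇔bounds ineq)) })
  (λ pv → φ𝟏≡0 , from valuation-ineq⇔bounds (from bounds⇔pv (swap pv)))
  where
  open Valuation A G φ

  bounds⇔pv : (⇒-Bound × ⇝-Bound) ⇔ (PV5 A G φ × PV4 A G φ)
  bounds⇔pv = ⇒-Bound⇔PV5 ×-⇔ ⇝-Bound⇔PV4
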